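{- Fix $n\ge1$ and let $m\ge n$. Then $$c_{n,m}(1)=\sum_{k=1}^{n} b_{n,k}\binom{m-1}{k-1}.$$
   Context: Words are finite sequences of positive integers; $|w|$ is the length of $w$. $P(w)$ is the insertion tableau of $w$ under the Robinson–Schensted–Knuth (row-insertion) correspondence, and $C(u)=\{w : P(uw)=P(wu)\}$ (juxtaposition is concatenation). $c_{n,m}(u)=\#\{w\in C(u): |w|=n,\ \max w\le m\}$. A word $w$ is $k$-packed if $\max w=k$ and every element of $\{1,\dots,k\}$ occurs in $w$. $b_{n,k}$ is the number of $k$-packed words $w\in C(1)$ with $|w|=n$. -}

module Defs where

open import Data.Nat using (ℕ; zero; suc; _<ᵇ_; _≟_)
open import Data.Nat.Combinatorics using (_C_)
open import Data.Bool using (Bool; true; false)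
open import Data.Product using (_×_; _,_)
open import Data.Maybe using (Maybe; just; nothing)
open import Data.List using (List; []; _∷_; _++_; [_]; map; concatMap; filter; length; applyUpTo; foldl)
open import Data.Nat.ListAction using (sum)
open import Data.List.Properties using (≡-dec)
open import Data.List.Relation.Unary.All using (All)
open import Data.List.Membership.Propositional using (_∈_)
open import Relation.Binary.PropositionalEquality using (_≡_)
open import Relation.Nullary using (Dec)

-- Words: finite sequences of positive integers, represented as List ℕ
-- (positivity is imposed where words are enumerated: letters range over 1..m).
Word : Set
Word = List ℕ

-- A (semistandard) tableau: list of rows, top row first.
Tableau : Set
Tableau = List (List ℕ)

rowInsert : ℕ → List ℕ → List ℕ × Maybe ℕ
rowInsert x [] = [ x ] , nothing
rowInsert x (y ∷ ys) with x <ᵇ y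
... | true  = x ∷ ys , just y
... | false with rowInsert x ys
...   | (ys' , b) = y ∷ ys' , b

insert : ℕ → Tableau → Tableau
insert x [] = [ x ] ∷ []
insert x (r ∷ rs) with rowInsert x r
... | (r' , nothing) = r' ∷ rs
... | (r' , just y)  = r' ∷ insert y rs

P : Word → Tableau
P w = foldl (λ t x → insert x t) [] w

InC : Word → Word → Set
InC u w = P (u ++ w) ≡ P (w ++ u)

InC? : (u w : Word) → Dec (InC u w)
InC? u w = ≡-dec (≡-dec _≟_) (P (u ++ w)) (P (w ++ u))

wordsOver : ℕ → ℕ → List Word
wordsOver zero    m = [] ∷ []
wordsOver (suc n) m = concatMap (λ a → map (a ∷_) (wordsOver n m)) (applyUpTo suc m)

c : ℕ → ℕ → Word → ℕ
c n m u = length (filter (InC? u) (wordsOver n m))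

-- w is k-packed: max w = k and every element of {1,…,k} occurs in w.
-- For w with letters in {1,…,k} (as enumerated below), max w = k is implied
-- by k ∈ w, so together with the letter bound this is the full condition.
Packed : ℕ → Word → Set
Packed k w = All (λ i → i ∈ w) (applyUpTo suc k)

Packed? : (k : ℕ) (w : Word) → Dec (Packed k w)
Packed? k w = Data.List.Relation.Unary.All.all? (λ i → Data.List.Membership.DecPropositional._∈?_ _≟_ i w) (applyUpTo suc k)
  where import Data.List.Membership.DecPropositional

b : ℕ → ℕ → ℕ
b n k = length (filter (λ w → InC? [ 1 ] w) (filter (Packed? k) (wordsOver n k)))

sumFrom1 : ℕ → (ℕ → ℕ) → ℕ
sumFrom1 n f = sum (applyUpTo (λ i → f (suc i)) n)

module Submission where

-- Let N n m j count the words of length n over {1,…,m} that lie in C(1) and contain each of 1,…,j.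
-- Relabelling by an order embedding commutes with row insertion, so an embedding fixing 1 preserves
-- membership in C(1). Splitting by whether j+1 occurs, and closing the gap left by an absent j+1,
-- gives the Pascal recurrence N n (m+1) j = N n (m+1) (j+1) + N n m j for 1 ≤ j ≤ m, whose solution
-- is N n (j+d) j = Σ_t b_{n,j+t} C(d,t). A nonempty word in C(1) contains 1 (if all its letters
-- exceed 1, inserting 1 first lengthens the first row of P(w) but inserting it last does not), so
-- c_{n,m}(1) = N n m 0 = N n m 1; and b_{n,k} = 0 for k > n by pigeonhole.

open import Defs
open import Data.Bool using (Bool; true; false; _∧_; not; if_then_else_; T)
open import Data.Bool.Properties using (∧-assoc; ∧-comm; ∧-identityʳ; ∧-zeroʳ)
open import Data.Empty using (⊥)
open import Data.Maybe as Maybe using (just; nothing)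
open import Data.Nat using (ℕ; zero; suc; _+_; _*_; _∸_; _≤_; _<_; _<ᵇ_; _≟_; z≤n; s≤s; z<s)
open import Data.Nat.Properties
  using ( +-suc; +-identityʳ; *-identityʳ; *-zeroʳ; *-distribˡ-+; suc-injective; 1+n≢n
        ; ≤-refl; ≤-antisym; m≤m+n; m<n⇒m<1+n; <⇒≢; <⇒≱; ≮⇒≥; n≮n; ≤∧≢⇒<; <ᵇ⇒<; <⇒<ᵇ
        ; +-commutativeSemigroup )
open import Algebra.Properties.CommutativeSemigroup +-commutativeSemigroup using (interchange; x∙yz≈y∙xz)
open import Data.Nat.Combinatorics using (_C_; nCk+nC[k+1]≡[n+1]C[k+1]; k>n⇒nCk≡0)
open import Data.Nat.ListAction using (sum)
open import Data.List using (List; []; _∷_; _∷ʳ_; _++_; [_]; map; foldl; concatMap; filter; length; applyUpTo)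
open import Data.List.Properties
  using (applyUpTo-∷ʳ; length-applyUpTo; length-++; map-++; map-injective; foldl-++; ∷-injectiveˡ)
open import Data.List.Relation.Unary.All as All using (All; []; _∷_)
open import Data.List.Relation.Unary.All.Properties
  using (concat⁺; map⁺; applyUpTo⁺₁; applyUpTo⁺₂; applyUpTo⁻; ∷ʳ⁺; ∷ʳ⁻)
open import Data.List.Relation.Unary.Any using (here; there)
open import Data.List.Relation.Unary.Unique.Propositional using (Unique; []; _∷_)
import Data.List.Relation.Unary.Unique.Propositional.Properties as Unique
open import Data.List.Membership.Propositional using (_∈_)
open import Data.List.Membership.Propositional.Properties
  using (∈-map⁺; ∈-map⁻; ∈-++⁻; ∈-++⁺ˡ; ∈-++⁺ʳ; ∈-∃++)
open import Data.List.Membership.DecPropositional _≟_ using (_∈?_)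
open import Data.Product as Product using (_×_; _,_; uncurry)
open import Data.Sum using (inj₁; inj₂)
open import Function using (_∘_)
open import Function.Bundles using (_⇔_; mk⇔; Equivalence)
open import Function.Definitions using (Injective)
open import Level using (Level)
open import Relation.Binary.PropositionalEquality hiding ([_])
open import Relation.Nullary using (does; yes; no; ¬_; contradiction)
open import Relation.Nullary.Decidable using (dec-true; dec-false; does-⇔; _×-dec_)
open import Relation.Unary using (Pred; Decidable)

private
  variable
    ℓ : Level
    A B : Set
    xs : List A

count : (A → Bool) → List A → ℕ
count p []       = 0
count p (x ∷ xs) = if p x then suc (count p xs) else count p xs

length-filter≡count : {P : Pred A ℓ} (P? : Decidable P) (xs : List A) →
                      length (filter P? xs) ≡ count (does ∘ P?) xs
length-filter≡count P? []       = refl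
length-filter≡count P? (x ∷ xs) with does (P? x)
... | true  = cong suc (length-filter≡count P? xs)
... | false = length-filter≡count P? xs

count-filter : {P : Pred A ℓ} (P? : Decidable P) (q : A → Bool) (xs : List A) →
               count q (filter P? xs) ≡ count (λ x → does (P? x) ∧ q x) xs
count-filter P? q []       = refl
count-filter P? q (x ∷ xs) with does (P? x)
... | false = count-filter P? q xs
... | true with q x
...   | true  = cong suc (count-filter P? q xs)
...   | false = count-filter P? q xs

count-++ : (p : A → Bool) (xs ys : List A) → count p (xs ++ ys) ≡ count p xs + count p ys
count-++ p []       ys = refl
count-++ p (x ∷ xs) ys with p x
... | true  = cong suc (count-++ p xs ys)
... | false = count-++ p xs ys

count-map : (p : B → Bool) (f : A → B) (xs : List A) → count p (map f xs) ≡ count (p ∘ f) xs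
count-map p f []       = refl
count-map p f (x ∷ xs) with p (f x)
... | true  = cong suc (count-map p f xs)
... | false = count-map p f xs

count-cong : {p q : A → Bool} → All (λ x → p x ≡ q x) xs → count p xs ≡ count q xs
count-cong                 []                = refl
count-cong {xs = x ∷ _} {q = q} (px≡qx ∷ ps) rewrite px≡qx =
  cong (λ n → if q x then suc n else n) (count-cong ps)

count-none : {p : A → Bool} → All (λ x → p x ≡ false) xs → count p xs ≡ 0
count-none []               = refl
count-none (px≡false ∷ ps) rewrite px≡false = count-none ps

count-split : (p r : A → Bool) (xs : List A) →
              count p xs ≡ count (λ x → p x ∧ r x) xs + count (λ x → p x ∧ not (r x)) xs
count-split p r []       = refl
count-split p r (x ∷ xs) with p x | r x
... | false | _     = count-split p r xs
... | true  | true  = cong suc (count-split p r xs)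
... | true  | false = trans (cong suc (count-split p r xs)) (sym (+-suc _ _))

∈-map-fixed⇔ : ∀ {f : A → A} {x xs} → Injective _≡_ _≡_ f → f x ≡ x → x ∈ map f xs ⇔ x ∈ xs
∈-map-fixed⇔ {f = f} {x} {xs} f-inj fx≡x = mk⇔ to (subst (_∈ map f xs) fx≡x ∘ ∈-map⁺ f)
  where
  to : x ∈ map f xs → x ∈ xs
  to x∈fxs with y , y∈xs , x≡fy ← ∈-map⁻ f x∈fxs =
    subst (_∈ xs) (f-inj (trans (sym x≡fy) (sym fx≡x))) y∈xs

∈-++-∷⁻ : ∀ {x y : A} us {vs} → x ≢ y → y ∈ us ++ x ∷ vs → y ∈ us ++ vs
∈-++-∷⁻ us x≢y y∈ with ∈-++⁻ us y∈
... | inj₁ y∈us          = ∈-++⁺ˡ y∈us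
... | inj₂ (here y≡x)    = contradiction (sym y≡x) x≢y
... | inj₂ (there y∈vs)  = ∈-++⁺ʳ us y∈vs

Unique⇒length≤ : ∀ {xs ys : List A} → Unique xs → All (_∈ ys) xs → length xs ≤ length ys
Unique⇒length≤ []             []             = z≤n
Unique⇒length≤ (x∉xs ∷ unique-xs) (x∈ys ∷ xs⊆ys) with us , vs , refl ← ∈-∃++ x∈ys =
  subst (suc _ ≤_) (sym length-us++x∷vs)
        (s≤s (Unique⇒length≤ unique-xs (All.map (uncurry (∈-++-∷⁻ us)) (All.zip (x∉xs , xs⊆ys)))))
  where
  length-us++x∷vs : length (us ++ _ ∷ vs) ≡ suc (length (us ++ vs))
  length-us++x∷vs = trans (length-++ us) (trans (+-suc _ _) (cong suc (sym (length-++ us))))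

punchIn : ℕ → ℕ → ℕ
punchIn zero    j       = suc j
punchIn (suc i) zero    = zero
punchIn (suc i) (suc j) = suc (punchIn i j)

punchIn-<ᵇ : ∀ i x y → (punchIn i x <ᵇ punchIn i y) ≡ (x <ᵇ y)
punchIn-<ᵇ zero    x       y       = refl
punchIn-<ᵇ (suc i) zero    zero    = refl
punchIn-<ᵇ (suc i) zero    (suc y) = refl
punchIn-<ᵇ (suc i) (suc x) zero    = refl
punchIn-<ᵇ (suc i) (suc x) (suc y) = punchIn-<ᵇ i x y

punchIn-≢ : ∀ i j → punchIn i j ≢ i
punchIn-≢ (suc i) (suc j) eq = punchIn-≢ i j (suc-injective eq)

punchIn-below : ∀ {i j} → j < i → punchIn i j ≡ j
punchIn-below {suc i} {zero}  _         = refl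
punchIn-below {suc i} {suc j} (s≤s j<i) = cong suc (punchIn-below j<i)

sum-applyUpTo-cong : ∀ {g h : ℕ → ℕ} n → (∀ t → g t ≡ h t) →
                     sum (applyUpTo g n) ≡ sum (applyUpTo h n)
sum-applyUpTo-cong zero    _   = refl
sum-applyUpTo-cong (suc n) g≗h = cong₂ _+_ (g≗h 0) (sum-applyUpTo-cong n (g≗h ∘ suc))

sum-applyUpTo-+ : ∀ (g h : ℕ → ℕ) n →
                  sum (applyUpTo (λ t → g t + h t) n) ≡ sum (applyUpTo g n) + sum (applyUpTo h n)
sum-applyUpTo-+ g h zero    = refl
sum-applyUpTo-+ g h (suc n) = trans (cong (g 0 + h 0 +_) (sum-applyUpTo-+ (g ∘ suc) (h ∘ suc) n))
                                    (interchange (g 0) (h 0) _ _)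

sum-applyUpTo-punchIn : ∀ (g : ℕ → ℕ) {i n} → i ≤ n →
                        sum (applyUpTo g (suc n)) ≡ g i + sum (applyUpTo (g ∘ punchIn i) n)
sum-applyUpTo-punchIn g {zero}  _         = refl
sum-applyUpTo-punchIn g {suc i} (s≤s i≤n) =
  trans (cong (g 0 +_) (sum-applyUpTo-punchIn (g ∘ suc) i≤n)) (x∙yz≈y∙xz (g 0) (g (suc i)) _)

sum-applyUpTo-truncate : ∀ (g : ℕ → ℕ) {n m} → n ≤ m → (∀ t → n ≤ t → g t ≡ 0) →
                         sum (applyUpTo g m) ≡ sum (applyUpTo g n)
sum-applyUpTo-truncate g {zero}  {zero}  _         _     = refl
sum-applyUpTo-truncate g {zero}  {suc m} _         g≡0   =
  cong₂ _+_ (g≡0 0 z≤n) (sum-applyUpTo-truncate (g ∘ suc) {m = m} z≤n (λ t _ → g≡0 (suc t) z≤n))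
sum-applyUpTo-truncate g {suc n} {suc m} (s≤s n≤m) g≡0   =
  cong (g 0 +_) (sum-applyUpTo-truncate (g ∘ suc) n≤m (λ t n≤t → g≡0 (suc t) (s≤s n≤t)))

module _ (f : ℕ → ℕ → ℕ)
         (f-pascal : ∀ m j → 1 ≤ j → j ≤ m → f (suc m) j ≡ f (suc m) (suc j) + f m j) where

  -- Summing over any L > d, rather than exactly d + 1 terms, lets the second induction
  -- hypothesis be used at L + 1 without splitting off its vanishing last term.
  pascal-closed : ∀ j d L → 1 ≤ j → d < L →
                  f (j + d) j ≡ sum (applyUpTo (λ t → f (j + t) (j + t) * (d C t)) L)
  pascal-closed j zero (suc L) _ _ = sym (begin
    f (j + 0) (j + 0) * 1 + sum (applyUpTo (λ t → f (j + suc t) (j + suc t) * (0 C suc t)) L)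
      ≡⟨ cong₂ _+_ (*-identityʳ _) (sum-applyUpTo-truncate _ {m = L} z≤n vanishes) ⟩
    f (j + 0) (j + 0) + 0
      ≡⟨ +-identityʳ _ ⟩
    f (j + 0) (j + 0)
      ≡⟨ cong (f (j + 0)) (+-identityʳ j) ⟩
    f (j + 0) j ∎)
    where
    open ≡-Reasoning
    vanishes : ∀ t → 0 ≤ t → f (j + suc t) (j + suc t) * (0 C suc t) ≡ 0
    vanishes t _ = trans (cong (f (j + suc t) (j + suc t) *_) (k>n⇒nCk≡0 (z<s {n = t})))
                         (*-zeroʳ (f (j + suc t) (j + suc t)))
  pascal-closed j (suc d) (suc L) 1≤j (s≤s d<L) = begin
    f (j + suc d) j
      ≡⟨ cong (λ m → f m j) (+-suc j d) ⟩
    f (suc (j + d)) j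
      ≡⟨ f-pascal (j + d) j 1≤j (m≤m+n j d) ⟩
    f (suc j + d) (suc j) + f (j + d) j
      ≡⟨ cong₂ _+_ (pascal-closed (suc j) d L (s≤s z≤n) d<L)
                   (pascal-closed j d (suc L) 1≤j (m<n⇒m<1+n d<L)) ⟩
    sum (applyUpTo (λ t → f (suc j + t) (suc j + t) * (d C t)) L) + (β 0 * 1 + S₂)
      ≡⟨ cong (_+ (β 0 * 1 + S₂))
              (sum-applyUpTo-cong L λ t → cong (λ k → f k k * (d C t)) (sym (+-suc j t))) ⟩
    S₁ + (β 0 * 1 + S₂)
      ≡⟨ x∙yz≈y∙xz S₁ (β 0 * 1) S₂ ⟩
    β 0 * 1 + (S₁ + S₂)
      ≡⟨ cong (β 0 * 1 +_) (sum-applyUpTo-+ _ _ L) ⟨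
    β 0 * 1 + sum (applyUpTo (λ t → β (suc t) * (d C t) + β (suc t) * (d C suc t)) L)
      ≡⟨ cong (β 0 * 1 +_) (sum-applyUpTo-cong L pascal-rule) ⟩
    β 0 * 1 + sum (applyUpTo (λ t → β (suc t) * (suc d C suc t)) L) ∎
    where
    open ≡-Reasoning
    β : ℕ → ℕ
    β t = f (j + t) (j + t)
    S₁ S₂ : ℕ
    S₁ = sum (applyUpTo (λ t → β (suc t) * (d C t)) L)
    S₂ = sum (applyUpTo (λ t → β (suc t) * (d C suc t)) L)
    pascal-rule : ∀ t → β (suc t) * (d C t) + β (suc t) * (d C suc t) ≡ β (suc t) * (suc d C suc t)
    pascal-rule t = trans (sym (*-distribˡ-+ (β (suc t)) _ _))
                          (cong (β (suc t) *_) (nCk+nC[k+1]≡[n+1]C[k+1] d t))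

wordsOver-shape : ∀ n m → All (λ w → length w ≡ n × All (1 ≤_) w) (wordsOver n m)
wordsOver-shape zero    m = (refl , []) ∷ []
wordsOver-shape (suc n) m =
  concat⁺ (map⁺ (applyUpTo⁺₂ suc m λ _ → map⁺ (All.map extend (wordsOver-shape n m))))
  where
  extend : ∀ {i w} → length w ≡ n × All (1 ≤_) w →
           length (suc i ∷ w) ≡ suc n × All (1 ≤_) (suc i ∷ w)
  extend (|w|≡n , w>0) = cong suc |w|≡n , s≤s z≤n ∷ w>0

count-wordsOver-suc : ∀ (p : Word → Bool) n m →
  count p (wordsOver (suc n) m) ≡ sum (applyUpTo (λ i → count (p ∘ (suc i ∷_)) (wordsOver n m)) m)
count-wordsOver-suc p n m = go suc m
  where
  W : List Word
  W = wordsOver n m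
  go : ∀ (letter : ℕ → ℕ) k →
       count p (concatMap (λ a → map (a ∷_) W) (applyUpTo letter k))
         ≡ sum (applyUpTo (λ i → count (p ∘ (letter i ∷_)) W) k)
  go letter zero    = refl
  go letter (suc k) = trans (count-++ p (map (letter 0 ∷_) W) _)
                            (cong₂ _+_ (count-map p (letter 0 ∷_) W) (go (letter ∘ suc) k))

count-wordsOver-avoiding : ∀ (p : Word → Bool) n {m j} → j ≤ m →
  count (λ w → p w ∧ not (does (suc j ∈? w))) (wordsOver n (suc m))
    ≡ count (p ∘ map (punchIn (suc j))) (wordsOver n m)
count-wordsOver-avoiding p zero j≤m rewrite ∧-identityʳ (p []) = refl
count-wordsOver-avoiding p (suc n) {m} {j} j≤m = begin
  count (λ w → p w ∧ not (does (suc j ∈? w))) (wordsOver (suc n) (suc m))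
    ≡⟨ count-wordsOver-suc _ n (suc m) ⟩
  sum (applyUpTo h (suc m))
    ≡⟨ sum-applyUpTo-punchIn h j≤m ⟩
  h j + sum (applyUpTo (h ∘ punchIn j) m)
    ≡⟨ cong₂ _+_ h[j]≡0 (sum-applyUpTo-cong m h[punchIn]) ⟩
  sum (applyUpTo (λ i → count (λ w → p (suc (punchIn j i) ∷ map (punchIn (suc j)) w)) (wordsOver n m)) m)
    ≡⟨ count-wordsOver-suc (p ∘ map (punchIn (suc j))) n m ⟨
  count (p ∘ map (punchIn (suc j))) (wordsOver (suc n) m) ∎
  where
  open ≡-Reasoning
  h : ℕ → ℕ
  h i = count (λ w → p (suc i ∷ w) ∧ not (does (suc j ∈? (suc i ∷ w)))) (wordsOver n (suc m))

  h[j]≡0 : h j ≡ 0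
  h[j]≡0 = count-none (All.universal drop (wordsOver n (suc m)))
    where
    drop : ∀ w → p (suc j ∷ w) ∧ not (does (suc j ∈? (suc j ∷ w))) ≡ false
    drop w rewrite dec-true (suc j ≟ suc j) refl = ∧-zeroʳ _

  h[punchIn] : ∀ i → h (punchIn j i)
                     ≡ count (λ w → p (suc (punchIn j i) ∷ map (punchIn (suc j)) w)) (wordsOver n m)
  h[punchIn] i = trans (count-cong (All.universal keep (wordsOver n (suc m))))
                       (count-wordsOver-avoiding (p ∘ (suc (punchIn j i) ∷_)) n j≤m)
    where
    keep : ∀ w → p (suc (punchIn j i) ∷ w) ∧ not (does (suc j ∈? (suc (punchIn j i) ∷ w)))
               ≡ p (suc (punchIn j i) ∷ w) ∧ not (does (suc j ∈? w))
    keep w rewrite dec-false (suc j ≟ suc (punchIn j i)) (punchIn-≢ j i ∘ sym ∘ suc-injective) = refl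

Packed-suc⇔ : ∀ k w → Packed (suc k) w ⇔ (Packed k w × suc k ∈ w)
Packed-suc⇔ k w =
  mk⇔ (∷ʳ⁻ ∘ subst (All (_∈ w)) (sym snoc)) (subst (All (_∈ w)) snoc ∘ uncurry ∷ʳ⁺)
  where
  snoc : applyUpTo suc k ∷ʳ suc k ≡ applyUpTo suc (suc k)
  snoc = applyUpTo-∷ʳ suc k

Packed-map⇔ : ∀ {f} k w → Injective _≡_ _≡_ f → (∀ i → i ≤ k → f i ≡ i) →
              Packed k (map f w) ⇔ Packed k w
Packed-map⇔ k w f-inj f-fixes =
  mk⇔ (transfer (Equivalence.to ∘ ∈f⇔∈)) (transfer (Equivalence.from ∘ ∈f⇔∈))
  where
  ∈f⇔∈ : ∀ {i} → suc i ≤ k → suc i ∈ map _ w ⇔ suc i ∈ w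
  ∈f⇔∈ i<k = ∈-map-fixed⇔ f-inj (f-fixes _ i<k)
  transfer : ∀ {v v′} → (∀ {i} → suc i ≤ k → suc i ∈ v → suc i ∈ v′) →
             Packed k v → Packed k v′
  transfer move p = applyUpTo⁺₁ suc k (λ i<k → move i<k (applyUpTo⁻ suc k p i<k))

Packed⇒≤length : ∀ k w → Packed k w → k ≤ length w
Packed⇒≤length k w p =
  subst (_≤ length w) (length-applyUpTo suc k)
        (Unique⇒length≤ (Unique.applyUpTo⁺₁ suc k (λ i<j _ → <⇒≢ (s≤s i<j))) p)

insertAll : Tableau → Word → Tableau
insertAll = foldl (λ t x → insert x t)

module _ {f : ℕ → ℕ} (f-<ᵇ : ∀ x y → (f x <ᵇ f y) ≡ (x <ᵇ y)) where

  rowInsert-map : ∀ x r → rowInsert (f x) (map f r) ≡ Product.map (map f) (Maybe.map f) (rowInsert x r)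
  rowInsert-map x []       = refl
  rowInsert-map x (y ∷ ys) rewrite f-<ᵇ x y with x <ᵇ y
  ... | true  = refl
  ... | false rewrite rowInsert-map x ys = refl

  insert-map : ∀ x t → insert (f x) (map (map f) t) ≡ map (map f) (insert x t)
  insert-map x []       = refl
  insert-map x (r ∷ rs) rewrite rowInsert-map x r with rowInsert x r
  ... | r′ , nothing = refl
  ... | r′ , just y  = cong (map f r′ ∷_) (insert-map y rs)

  insertAll-map : ∀ t w → insertAll (map (map f) t) (map f w) ≡ map (map f) (insertAll t w)
  insertAll-map t []      = refl
  insertAll-map t (x ∷ w) rewrite insert-map x t = insertAll-map (insert x t) w

  P-map : ∀ w → P (map f w) ≡ map (map f) (P w)
  P-map = insertAll-map []

  <ᵇ-preserving⇒injective : Injective _≡_ _≡_ f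
  <ᵇ-preserving⇒injective {x} {y} fx≡fy =
    ≤-antisym (≮⇒≥ (not-below fx≡fy)) (≮⇒≥ (not-below (sym fx≡fy)))
    where
    not-below : ∀ {x y} → f x ≡ f y → ¬ y < x
    not-below {x} {y} fx≡fy y<x =
      n≮n (f y) (<ᵇ⇒< (f y) (f y) (subst (λ z → T (f y <ᵇ z)) fx≡fy
                                          (subst T (sym (f-<ᵇ y x)) (<⇒<ᵇ y<x))))

  InC-map⇔ : ∀ u w → InC (map f u) (map f w) ⇔ InC u w
  InC-map⇔ u w = mk⇔ to from
    where
    P-map-++ : ∀ u w → P (map f u ++ map f w) ≡ map (map f) (P (u ++ w))
    P-map-++ u w = trans (cong P (sym (map-++ f u w))) (P-map (u ++ w))
    to : InC (map f u) (map f w) → InC u w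
    to e = map-injective (map-injective <ᵇ-preserving⇒injective)
             (trans (sym (P-map-++ u w)) (trans e (P-map-++ w u)))
    from : InC u w → InC (map f u) (map f w)
    from e = trans (P-map-++ u w) (trans (cong (map (map f)) e) (sym (P-map-++ w u)))

prependOne : Tableau → Tableau
prependOne []       = [ 1 ] ∷ []
prependOne (r ∷ rs) = (1 ∷ r) ∷ rs

insert-prependOne : ∀ {x} t → 1 < x → insert x (prependOne t) ≡ prependOne (insert x t)
insert-prependOne []       (s≤s (s≤s _)) = refl
insert-prependOne {x} (r ∷ rs) (s≤s (s≤s _)) with rowInsert x r
... | r′ , nothing = refl
... | r′ , just y  = refl

insertAll-prependOne : ∀ t w → All (1 <_) w → insertAll (prependOne t) w ≡ prependOne (insertAll t w)
insertAll-prependOne t []      []           = refl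
insertAll-prependOne t (x ∷ w) (1<x ∷ 1<w) rewrite insert-prependOne t 1<x =
  insertAll-prependOne (insert x t) w 1<w

TopLeft>1 : Tableau → Set
TopLeft>1 ((y ∷ _) ∷ _) = 1 < y
TopLeft>1 _             = ⊥

insert-TopLeft>1 : ∀ {x} t → 1 < x → TopLeft>1 t → TopLeft>1 (insert x t)
insert-TopLeft>1 {x} ((y ∷ ys) ∷ rs) 1<x 1<y with x <ᵇ y
... | true  = 1<x
... | false with rowInsert x ys
...   | _ , nothing = 1<y
...   | _ , just _  = 1<y

insertAll-TopLeft>1 : ∀ t w → All (1 <_) w → TopLeft>1 t → TopLeft>1 (insertAll t w)
insertAll-TopLeft>1 t []      []           h = h
insertAll-TopLeft>1 t (x ∷ w) (1<x ∷ 1<w) h =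
  insertAll-TopLeft>1 (insert x t) w 1<w (insert-TopLeft>1 t 1<x h)

prependOne≢insert1 : ∀ t → TopLeft>1 t → prependOne t ≢ insert 1 t
prependOne≢insert1 ((_ ∷ _) ∷ _) (s≤s (s≤s _)) e =
  1+n≢n (suc-injective (cong length (∷-injectiveˡ e)))

¬InC-[1]-above1 : ∀ {x} w → All (1 <_) (x ∷ w) → ¬ InC [ 1 ] (x ∷ w)
¬InC-[1]-above1 {x} w 1<xw@(1<x ∷ 1<w) commutes =
  prependOne≢insert1 (P (x ∷ w)) (insertAll-TopLeft>1 ([ x ] ∷ []) w 1<w 1<x) (begin
    prependOne (P (x ∷ w))  ≡⟨ insertAll-prependOne [] (x ∷ w) 1<xw ⟨
    P (1 ∷ x ∷ w)           ≡⟨ commutes ⟩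
    P ((x ∷ w) ++ [ 1 ])    ≡⟨ foldl-++ (λ t x → insert x t) [] (x ∷ w) [ 1 ] ⟩
    insert 1 (P (x ∷ w))    ∎)
  where open ≡-Reasoning

InC-[1]⇒1∈ : ∀ {x} w → All (1 ≤_) (x ∷ w) → InC [ 1 ] (x ∷ w) → 1 ∈ x ∷ w
InC-[1]⇒1∈ {x} w 1≤xw commutes with 1 ∈? (x ∷ w)
... | yes 1∈xw = 1∈xw
... | no  1∉xw = contradiction commutes (¬InC-[1]-above1 w (All.tabulate above1))
  where
  above1 : ∀ {y} → y ∈ x ∷ w → 1 < y
  above1 y∈xw =
    ≤∧≢⇒< (All.lookup 1≤xw y∈xw) (λ 1≡y → 1∉xw (subst (_∈ x ∷ w) (sym 1≡y) y∈xw))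

module _ {Q : Pred Word ℓ} (Q? : Decidable Q) where

  countPacked : ℕ → ℕ → ℕ → ℕ
  countPacked n m j = count (λ w → does (Q? w) ∧ does (Packed? j w)) (wordsOver n m)

  countPacked-0 : ∀ n m → countPacked n m 0 ≡ count (does ∘ Q?) (wordsOver n m)
  countPacked-0 n m = count-cong (All.universal (λ w → ∧-identityʳ (does (Q? w))) (wordsOver n m))

  countPacked-1 : (∀ {x} w → All (1 ≤_) (x ∷ w) → Q (x ∷ w) → 1 ∈ x ∷ w) →
                  ∀ n m → countPacked (suc n) m 1 ≡ countPacked (suc n) m 0
  countPacked-1 Q⇒1∈ n m = count-cong (All.map contains1 (wordsOver-shape (suc n) m))
    where
    contains1 : ∀ {w} → length w ≡ suc n × All (1 ≤_) w →
                does (Q? w) ∧ does (Packed? 1 w) ≡ does (Q? w) ∧ does (Packed? 0 w)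
    contains1 {x ∷ w} (_ , 1≤xw) with Q? (x ∷ w)
    ... | no  _  = refl
    ... | yes Qw = cong (_∧ true) (dec-true (1 ∈? x ∷ w) (Q⇒1∈ w 1≤xw Qw))

  countPacked-pascal : (∀ a w → 1 < a → Q (map (punchIn a) w) ⇔ Q w) →
                       ∀ n m j → 1 ≤ j → j ≤ m →
                       countPacked n (suc m) j ≡ countPacked n (suc m) (suc j) + countPacked n m j
  countPacked-pascal Q-punchIn n m j 1≤j j≤m = begin
    countPacked n (suc m) j
      ≡⟨ count-split _ (λ w → does (suc j ∈? w)) (wordsOver n (suc m)) ⟩
    count (λ w → selected w ∧ does (suc j ∈? w)) (wordsOver n (suc m))
      + count (λ w → selected w ∧ not (does (suc j ∈? w))) (wordsOver n (suc m))
      ≡⟨ cong₂ _+_ (count-cong (All.universal with-suc-j (wordsOver n (suc m))))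
                   (count-wordsOver-avoiding selected n j≤m) ⟩
    countPacked n (suc m) (suc j) + count (selected ∘ map (punchIn (suc j))) (wordsOver n m)
      ≡⟨ cong (countPacked n (suc m) (suc j) +_) (count-cong (All.universal relabel (wordsOver n m))) ⟩
    countPacked n (suc m) (suc j) + countPacked n m j ∎
    where
    open ≡-Reasoning
    selected : Word → Bool
    selected w = does (Q? w) ∧ does (Packed? j w)

    with-suc-j : ∀ w → selected w ∧ does (suc j ∈? w) ≡ does (Q? w) ∧ does (Packed? (suc j) w)
    with-suc-j w = trans (∧-assoc (does (Q? w)) _ _) (cong (does (Q? w) ∧_)
      (sym (does-⇔ (Packed-suc⇔ j w) (Packed? (suc j) w) (Packed? j w ×-dec suc j ∈? w))))

    relabel : ∀ w → selected (map (punchIn (suc j)) w) ≡ selected w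
    relabel w = cong₂ _∧_
      (does-⇔ (Q-punchIn (suc j) w (s≤s 1≤j)) (Q? (map (punchIn (suc j)) w)) (Q? w))
      (does-⇔ (Packed-map⇔ j w (<ᵇ-preserving⇒injective (punchIn-<ᵇ (suc j)))
                             (λ _ i≤j → punchIn-below (s≤s i≤j)))
              (Packed? j (map (punchIn (suc j)) w)) (Packed? j w))

  countPacked-vanish : ∀ {n j} m → n < j → countPacked n m j ≡ 0
  countPacked-vanish {n} {j} m n<j = count-none (All.map unpacked (wordsOver-shape n m))
    where
    unpacked : ∀ {w} → length w ≡ n × All (1 ≤_) w → does (Q? w) ∧ does (Packed? j w) ≡ false
    unpacked {w} (|w|≡n , _)
      rewrite dec-false (Packed? j w) (<⇒≱ n<j ∘ subst (j ≤_) |w|≡n ∘ Packed⇒≤length j w) =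
        ∧-zeroʳ (does (Q? w))

InC-[1]-punchIn⇔ : ∀ a w → 1 < a → InC [ 1 ] (map (punchIn a) w) ⇔ InC [ 1 ] w
InC-[1]-punchIn⇔ a w (s≤s (s≤s _)) = InC-map⇔ (punchIn-<ᵇ a) [ 1 ] w

c≡countPacked : ∀ n m → c n m [ 1 ] ≡ countPacked (InC? [ 1 ]) n m 0
c≡countPacked n m =
  trans (length-filter≡count (InC? [ 1 ]) (wordsOver n m)) (sym (countPacked-0 (InC? [ 1 ]) n m))

b≡countPacked : ∀ n k → b n k ≡ countPacked (InC? [ 1 ]) n k k
b≡countPacked n k = begin
  b n k
    ≡⟨ length-filter≡count (InC? [ 1 ]) (filter (Packed? k) (wordsOver n k)) ⟩
  count inC1 (filter (Packed? k) (wordsOver n k))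
    ≡⟨ count-filter (Packed? k) inC1 (wordsOver n k) ⟩
  count (λ w → does (Packed? k w) ∧ inC1 w) (wordsOver n k)
    ≡⟨ count-cong (All.universal (λ w → ∧-comm (does (Packed? k w)) (inC1 w)) (wordsOver n k)) ⟩
  countPacked (InC? [ 1 ]) n k k ∎
  where
  open ≡-Reasoning
  inC1 : Word → Bool
  inC1 = does ∘ InC? [ 1 ]

b≡0 : ∀ {n k} → n < k → b n k ≡ 0
b≡0 {n} {k} n<k = trans (b≡countPacked n k) (countPacked-vanish (InC? [ 1 ]) k n<k)

corollary4p4 : (n m : ℕ) → 1 ≤ n → n ≤ m →
    c n m [ 1 ] ≡ sumFrom1 n (λ k → b n k * ((m ∸ 1) C (k ∸ 1)))
corollary4p4 (suc n) (suc m) _ (s≤s n≤m) = begin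
  c (suc n) (suc m) [ 1 ]
    ≡⟨ c≡countPacked (suc n) (suc m) ⟩
  N (suc m) 0
    ≡⟨ countPacked-1 (InC? [ 1 ]) InC-[1]⇒1∈ n (suc m) ⟨
  N (1 + m) 1
    ≡⟨ pascal-closed N (countPacked-pascal (InC? [ 1 ]) InC-[1]-punchIn⇔ (suc n))
                     1 m (suc m) (s≤s z≤n) ≤-refl ⟩
  sum (applyUpTo (λ t → N (1 + t) (1 + t) * (m C t)) (suc m))
    ≡⟨ sum-applyUpTo-cong (suc m) (λ t → cong (_* (m C t)) (sym (b≡countPacked (suc n) (1 + t)))) ⟩
  sum (applyUpTo (λ t → b (suc n) (1 + t) * (m C t)) (suc m))
    ≡⟨ sum-applyUpTo-truncate _ (s≤s n≤m) (λ t n<t → cong (_* (m C t)) (b≡0 (s≤s n<t))) ⟩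
  sum (applyUpTo (λ t → b (suc n) (1 + t) * (m C t)) (suc n)) ∎
  where
  open ≡-Reasoning
  N : ℕ → ℕ → ℕ
  N = countPacked (InC? [ 1 ]) (suc n)
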